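{- Let $M\models T_{\mathrm{MSO(Fin)}}$ be infinite and define $\tilde r_M:\mathbb{N}_{>1}\to\mathbb{N}$ by letting $\tilde r_M(d)$ be the unique $h\in\{0,\dots,d-1\}$ such that $M\models\rho_{d,h}$. Then $\tilde r_M$ is a residue function.
   Context: $\mathbb{N}=\{0,1,2,\dots\}$, $\mathbb{P}$ the primes. Let $\mathcal{L}=\{\subseteq,\bot,\mathrm{At},\lhd\}$ be the first-order language with binary relation symbols $\subseteq,\lhd$, a constant $\bot$ and a unary relation symbol $\mathrm{At}$. Lowercase variables range over atoms; $X(x)$ abbreviates $x\subseteq X$. $T_{\mathrm{base}}$ states: $\subseteq$ is an atomic Boolean algebra order (one-element algebra allowed); $\lhd$ linearly orders the atoms; $\bot$ is least; $\mathrm{At}$ holds exactly of atoms; $\forall X\forall Y(X\lhd Y\leftrightarrow\exists x\exists y(X(x)\wedge Y(y)\wedge x\lhd y))$; and for every $\mathcal{L}$-formula $\eta(x;\bar Y)$, $\forall\bar Y\exists X\forall x(X(x)\leftrightarrow\eta(x;\bar Y))$. $T_{\mathrm{MSO(Fin)}}$ is $T_{\mathrm{base}}$ plus: the order on atoms is discrete with endpoints, and every $X\neq\bot$ contains a $\lhd$-least atom; $0,0^*$ denote the least and greatest atoms. For $d\ge1$ and $1\le h\le d$, $\rho_{d,h}$ says: there exist non-bottom $A_1,\dots,A_d$ partitioning the atoms with $A_1(0)$; for every atom $a\neq0^*$ and $1\le i\le d$, $A_i(a)$ implies $A_{i'}(a')$ where $a'$ is the immediate successor of $a$ and $i'=i+1$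 if $i<d$, $i'=1$ if $i=d$; and $A_h(0^*)$. For any integer $h$, $\rho_{d,h}$ means $\rho_{d,h'}$ with $h'\in\{1,\dots,d\}$, $h'\equiv h\pmod d$. (In an infinite model, for each $d$ exactly one $h\in\{1,\dots,d\}$ has $M\models\rho_{d,h}$.) A function $\tilde r:\mathbb{N}_{>1}\to\mathbb{N}$ is a residue function if there is $r:\mathbb{P}\times\mathbb{N}_{>0}\to\mathbb{N}$ with $r(p,j)<p^j$ and $r(p,j+1)\equiv r(p,j)\pmod{p^j}$ for all $p,j$, such that $\tilde r(d)<d$ for all $d$ and $\tilde r(d)\equiv r(p,j)\pmod{p^j}$ whenever $p^j\mid d$. -}

module Defs where

open import Level using (0ℓ)
open import Data.Nat using (ℕ; zero; suc; _+_; _*_; _^_; _<_; _≤_)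
open import Data.Nat.DivMod using (_%_; m%n<n)
open import Data.Nat.Divisibility using (_∣_)
open import Data.Nat.Primality using (Prime)
open import Data.Fin using (Fin; toℕ; fromℕ<)
import Data.Fin as F
open import Data.Vec.Functional using (_∷_)
open import Data.Product using (Σ; Σ-syntax; ∃; _×_; _,_)
open import Data.Sum using (_⊎_)
open import Data.Empty using (⊥)
open import Data.Unit using (⊤)
open import Relation.Nullary using (¬_)
open import Relation.Binary.PropositionalEquality using (_≡_)

record Structure : Set₁ where
  field
    C    : Set
    _⊑_  : C → C → Set
    bot  : C
    At   : C → Set
    _◁_  : C → C → Set
  infix 4 _⊑_ _◁_

data Tm (n : ℕ) : Set where
  var  : Fin n → Tm n
  botT : Tm n

data Fm (n : ℕ) : Set where
  _≐_ _⊆ᶠ_ _◁ᶠ_ : Tm n → Tm n → Fm n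
  atᶠ          : Tm n → Fm n
  ff           : Fm n
  _⇒_ _∧ᶠ_ _∨ᶠ_ : Fm n → Fm n → Fm n
  allᶠ exᶠ     : Fm (suc n) → Fm n

module _ (M : Structure) where
  open Structure M

  evalT : ∀ {n} → Tm n → (Fin n → C) → C
  evalT (var i) ρ = ρ i
  evalT botT    ρ = bot

  Sat : ∀ {n} → Fm n → (Fin n → C) → Set
  Sat (s ≐ t)   ρ = evalT s ρ ≡ evalT t ρ
  Sat (s ⊆ᶠ t)  ρ = evalT s ρ ⊑ evalT t ρ
  Sat (s ◁ᶠ t)  ρ = evalT s ρ ◁ evalT t ρ
  Sat (atᶠ t)   ρ = At (evalT t ρ)
  Sat ff        ρ = ⊥
  Sat (φ ⇒ ψ)   ρ = Sat φ ρ → Sat ψ ρ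
  Sat (φ ∧ᶠ ψ)  ρ = Sat φ ρ × Sat ψ ρ
  Sat (φ ∨ᶠ ψ)  ρ = Sat φ ρ ⊎ Sat ψ ρ
  Sat (allᶠ φ)  ρ = (x : C) → Sat φ (x ∷ ρ)
  Sat (exᶠ φ)   ρ = Σ[ x ∈ C ] Sat φ (x ∷ ρ)

  IsUB IsLB IsLub IsGlb : C → C → C → Set
  IsUB X Y Z = X ⊑ Z × Y ⊑ Z
  IsLB X Y Z = Z ⊑ X × Z ⊑ Y
  IsLub X Y Z = IsUB X Y Z × (∀ W → IsUB X Y W → Z ⊑ W)
  IsGlb X Y Z = IsLB X Y Z × (∀ W → IsLB X Y W → W ⊑ Z)

  IsTop : C → Set
  IsTop T = ∀ X → X ⊑ T

  IsAtomElt : C → Set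
  IsAtomElt a = ¬ (a ≡ bot) × (∀ Y → Y ⊑ a → Y ≡ bot ⊎ Y ≡ a)

  -- ⊑ is an atomic Boolean algebra order with least element bot
  -- (the one-element algebra is allowed), and At holds exactly of atoms
  record IsAtomicBA : Set where
    field
      refl⊑    : ∀ X → X ⊑ X
      antisym⊑ : ∀ X Y → X ⊑ Y → Y ⊑ X → X ≡ Y
      trans⊑   : ∀ X Y Z → X ⊑ Y → Y ⊑ Z → X ⊑ Z
      lub      : ∀ X Y → Σ[ Z ∈ C ] IsLub X Y Z
      glb      : ∀ X Y → Σ[ Z ∈ C ] IsGlb X Y Z
      top      : Σ[ T ∈ C ] IsTop T
      botLeast : ∀ X → bot ⊑ X
      distrib  : ∀ X Y Z YZ XYZ XY XZ W →
                 IsLub Y Z YZ → IsGlb X YZ XYZ →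
                 IsGlb X Y XY → IsGlb X Z XZ → IsLub XY XZ W → XYZ ≡ W
      compl    : ∀ X → Σ[ Y ∈ C ] (IsGlb X Y bot × Σ[ T ∈ C ] (IsTop T × IsLub X Y T))
      atomic   : ∀ X → ¬ (X ≡ bot) → Σ[ a ∈ C ] (IsAtomElt a × a ⊑ X)
      atIff    : ∀ a → (At a → IsAtomElt a) × (IsAtomElt a → At a)

  IsLeastAtom IsGreatestAtom : C → Set
  IsLeastAtom z    = At z × (∀ y → At y → z ≡ y ⊎ z ◁ y)
  IsGreatestAtom w = At w × (∀ y → At y → w ≡ y ⊎ y ◁ w)

  IsSucc : C → C → Set
  IsSucc a a' = At a × At a' × a ◁ a' × (∀ y → At y → ¬ (a ◁ y × y ◁ a'))

  record IsBase : Set where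
    field
      ba        : IsAtomicBA
      irrefl◁   : ∀ a → At a → ¬ (a ◁ a)
      trans◁    : ∀ a b c → At a → At b → At c → a ◁ b → b ◁ c → a ◁ c
      total◁    : ∀ a b → At a → At b → a ◁ b ⊎ a ≡ b ⊎ b ◁ a
      lift◁     : ∀ X Y → (X ◁ Y → Σ[ x ∈ C ] Σ[ y ∈ C ] (At x × At y × x ⊑ X × y ⊑ Y × x ◁ y))
                        × (Σ[ x ∈ C ] Σ[ y ∈ C ] (At x × At y × x ⊑ X × y ⊑ Y × x ◁ y) → X ◁ Y)
      compr     : ∀ n (η : Fm (suc n)) (Ys : Fin n → C) →
                  Σ[ X ∈ C ] (∀ x → At x → (x ⊑ X → Sat η (x ∷ Ys)) × (Sat η (x ∷ Ys) → x ⊑ X))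

  record IsMSOFin : Set where
    field
      base      : IsBase
      least     : Σ[ z ∈ C ] IsLeastAtom z
      greatest  : Σ[ w ∈ C ] IsGreatestAtom w
      succEx    : ∀ a → At a → ¬ IsGreatestAtom a → Σ[ a' ∈ C ] IsSucc a a'
      predEx    : ∀ a → At a → ¬ IsLeastAtom a → Σ[ a' ∈ C ] IsSucc a' a
      wellFnd   : ∀ X → ¬ (X ≡ bot) →
                  Σ[ x ∈ C ] (At x × x ⊑ X × (∀ y → At y → y ⊑ X → x ≡ y ⊎ x ◁ y))

  -- ρ_{d,i+1} for d = suc k, parts indexed by Fin (suc k) (index i ↔ A_{i+1})

  nextIdx : ∀ {k} → Fin (suc k) → Fin (suc k)
  nextIdx {k} i = fromℕ< (m%n<n (suc (toℕ i)) (suc k))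

  RhoIdx : (k : ℕ) → Fin (suc k) → Set
  RhoIdx k h = Σ[ A ∈ (Fin (suc k) → C) ]
      ((∀ i → ¬ (A i ≡ bot))
     × (∀ a → At a → Σ[ i ∈ Fin (suc k) ] (a ⊑ A i × (∀ j → a ⊑ A j → j ≡ i)))
     × (∀ z → IsLeastAtom z → z ⊑ A F.zero)
     × (∀ a a' → IsSucc a a' → ∀ i → a ⊑ A i → a' ⊑ A (nextIdx i))
     × (∀ w → IsGreatestAtom w → w ⊑ A h))

  -- ρ_{d,h} for any h ∈ ℕ: the index h' ∈ {1..d} with h' ≡ h (mod d),
  -- i.e. 0-based index (h + d - 1) mod d.  Only used for d ≥ 1.
  Rho : (d h : ℕ) → Set
  Rho zero    h = ⊥
  Rho (suc k) h = RhoIdx k (fromℕ< (m%n<n (h + k) (suc k)))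

Infinite : Set → Set
Infinite A = ∀ n → ¬ (Σ[ f ∈ (Fin n → A) ] (∀ a → Σ[ i ∈ Fin n ] f i ≡ a))

_≡_[mod_] : ℕ → ℕ → ℕ → Set
a ≡ b [mod m ] = Σ[ k ∈ ℕ ] Σ[ l ∈ ℕ ] a + k * m ≡ b + l * m

-- r̃ : ℕ_{>1} → ℕ represented as ℕ → ℕ (values at 0,1 irrelevant);
-- r : ℙ × ℕ_{>0} → ℕ represented as ℕ → ℕ → ℕ (constraints only on the domain)
IsResidueFunction : (ℕ → ℕ) → Set
IsResidueFunction r̃ = Σ[ r ∈ (ℕ → ℕ → ℕ) ]
    ((∀ p j → Prime p → 1 ≤ j → r p j < p ^ j)
   × (∀ p j → Prime p → 1 ≤ j → r p (suc j) ≡ r p j [mod p ^ j ])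
   × (∀ d → 1 < d → r̃ d < d)
   × (∀ d p j → 1 < d → Prime p → 1 ≤ j → p ^ j ∣ d → r̃ d ≡ r p j [mod p ^ j ]))

{-# OPTIONS --safe #-}
-- Let A and B be the ρ-partitions for d and for a divisor e of d, and call an
-- atom good if it lies in B (i mod e) whenever it lies in A i. Goodness is
-- definable from the parts, so by comprehension and the well-foundedness of ◁
-- a bad atom would yield a least one. It cannot be the least atom (both
-- partitions start at index 0), nor the successor of a good atom (both advance
-- cyclically along successors, compatibly with i ↦ i mod e). Hence the greatest
-- atom is good: the ρ-index for e is the ρ-index for d reduced mod e, i.e.
-- r̃ d ≡ r̃ e (mod e), and r p j = r̃ (p ^ j) witnesses a residue function.
module Submission where

open import Defs
open import Level using (0ℓ)
open import Axiom.ExcludedMiddle using (ExcludedMiddle)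
open import Data.Nat using (ℕ; zero; suc; _+_; _*_; _^_; _<_; _≤_; s≤s; z≤n; NonZero; nonTrivial⇒n>1)
open import Data.Nat.Properties using (+-suc; ^-monoʳ-<; +-commutativeSemigroup)
open import Algebra.Properties.CommutativeSemigroup +-commutativeSemigroup using (xy∙z≈xz∙y)
open import Data.Nat.DivMod
  using (_%_; _/_; m%n<n; m%n%n≡m%n; [m+n]%n≡m%n; %-distribˡ-+; %-remove-+ʳ; m∣n⇒o%n%m≡o%m; m≡m%n+[m/n]*n)
open import Data.Nat.Divisibility using (_∣_; n∣m*n)
open import Data.Nat.Primality using (Prime; prime⇒nonTrivial)
open import Data.Fin as F using (Fin; toℕ; fromℕ<; _↑ˡ_; _↑ʳ_)
open import Data.Fin.Properties using (toℕ-injective; toℕ-fromℕ<)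
open import Data.Vec.Functional using (_∷_; _++_)
open import Data.Vec.Functional.Properties using (lookup-++ˡ; lookup-++ʳ)
open import Data.Product using (Σ-syntax; _×_; _,_; proj₁; proj₂)
open import Data.Sum using (_⊎_; inj₁; inj₂)
open import Data.Empty using (⊥-elim)
open import Function using (_∘_)
open import Relation.Nullary using (¬_; yes; no)
open import Relation.Binary.PropositionalEquality using (_≡_; refl; sym; trans; cong; subst; module ≡-Reasoning)

open ≡-Reasoning

%-cong-suc : ∀ {x y} n .{{_ : NonZero n}} → x % n ≡ y % n → suc x % n ≡ suc y % n
%-cong-suc {x} {y} n x≡y = begin
  suc x % n            ≡⟨ %-distribˡ-+ 1 x n ⟩
  (1 % n + x % n) % n  ≡⟨ cong (λ z → (1 % n + z) % n) x≡y ⟩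
  (1 % n + y % n) % n  ≡⟨ %-distribˡ-+ 1 y n ⟨
  suc y % n            ∎

%-cancel-pred-shift : ∀ x y {k m} → suc m ∣ suc k →
                      (x + k) % suc m ≡ (y + m) % suc m → x % suc m ≡ y % suc m
%-cancel-pred-shift x y {k} {m} e∣d eq = begin
  x % suc m              ≡⟨ %-remove-+ʳ x e∣d ⟨
  (x + suc k) % suc m    ≡⟨ cong (_% suc m) (+-suc x k) ⟩
  suc (x + k) % suc m    ≡⟨ %-cong-suc (suc m) eq ⟩
  suc (y + m) % suc m    ≡⟨ cong (_% suc m) (+-suc y m) ⟨
  (y + suc m) % suc m    ≡⟨ [m+n]%n≡m%n y (suc m) ⟩
  y % suc m              ∎

%-≡⇒≡[mod] : ∀ {x y} n .{{_ : NonZero n}} → x % n ≡ y % n → x ≡ y [mod n ]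
%-≡⇒≡[mod] {x} {y} n x≡y = y / n , x / n , (begin
  x + y / n * n                  ≡⟨ cong (_+ y / n * n) (m≡m%n+[m/n]*n x n) ⟩
  x % n + x / n * n + y / n * n  ≡⟨ cong (λ z → z + x / n * n + y / n * n) x≡y ⟩
  y % n + x / n * n + y / n * n  ≡⟨ xy∙z≈xz∙y (y % n) (x / n * n) (y / n * n) ⟩
  y % n + y / n * n + x / n * n  ≡⟨ cong (_+ x / n * n) (m≡m%n+[m/n]*n y n) ⟨
  y + x / n * n                  ∎)

prime-power>1 : ∀ {p j} → Prime p → 1 ≤ j → 1 < p ^ j
prime-power>1 {p} {suc j} p-prime _ =
  ^-monoʳ-< p (nonTrivial⇒n>1 p {{prime⇒nonTrivial p-prime}}) {0} {suc j} (s≤s z≤n)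

reduce% : ∀ {d} e .{{_ : NonZero e}} → Fin d → Fin e
reduce% e i = fromℕ< (m%n<n (toℕ i) e)

⋀ : ∀ {n} k → (Fin k → Fm n) → Fm n
⋀ zero    φ = ff ⇒ ff
⋀ (suc k) φ = φ F.zero ∧ᶠ ⋀ k (φ ∘ F.suc)

module _ (M : Structure) where

  Sat-⋀⁺ : ∀ {n} k (φ : Fin k → Fm n) ρ → (∀ i → Sat M (φ i) ρ) → Sat M (⋀ k φ) ρ
  Sat-⋀⁺ zero    φ ρ sat = λ ()
  Sat-⋀⁺ (suc k) φ ρ sat = sat F.zero , Sat-⋀⁺ k (φ ∘ F.suc) ρ (sat ∘ F.suc)

  Sat-⋀⁻ : ∀ {n} k (φ : Fin k → Fm n) ρ → Sat M (⋀ k φ) ρ → ∀ i → Sat M (φ i) ρ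
  Sat-⋀⁻ (suc k) φ ρ (sat₀ , _)   F.zero    = sat₀
  Sat-⋀⁻ (suc k) φ ρ (_    , sat) (F.suc i) = Sat-⋀⁻ k (φ ∘ F.suc) ρ sat i

  reduce%-zero : ∀ {k} m → reduce% (suc m) (F.zero {k}) ≡ F.zero
  reduce%-zero m = toℕ-injective (toℕ-fromℕ< (m%n<n 0 (suc m)))

  reduce%-nextIdx : ∀ {k m} → suc m ∣ suc k → (i : Fin (suc k)) →
                    reduce% (suc m) (nextIdx M i) ≡ nextIdx M (reduce% (suc m) i)
  reduce%-nextIdx {k} {m} e∣d i = toℕ-injective (begin
    toℕ (reduce% e (nextIdx M i))   ≡⟨ toℕ-fromℕ< _ ⟩
    toℕ (nextIdx M i) % e           ≡⟨ cong (_% e) (toℕ-fromℕ< (m%n<n (suc (toℕ i)) (suc k))) ⟩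
    suc (toℕ i) % suc k % e         ≡⟨ m∣n⇒o%n%m≡o%m e (suc k) (suc (toℕ i)) e∣d ⟩
    suc (toℕ i) % e                 ≡⟨ %-cong-suc e (m%n%n≡m%n (toℕ i) e) ⟨
    suc (toℕ i % e) % e             ≡⟨ cong (λ t → suc t % e) (toℕ-fromℕ< _) ⟨
    suc (toℕ (reduce% e i)) % e     ≡⟨ toℕ-fromℕ< _ ⟨
    toℕ (nextIdx M (reduce% e i))   ∎)
    where e = suc m

module _ (em : ExcludedMiddle 0ℓ) (M : Structure) (mso : IsMSOFin M) where
  open Structure M
  open IsMSOFin mso
  open IsBase base
  open IsAtomicBA ba

  atom⋢bot : ∀ {x} → At x → ¬ (x ⊑ bot)
  atom⋢bot {x} at-x x⊑bot = proj₁ (proj₁ (atIff x) at-x) (antisym⊑ x bot x⊑bot (botLeast x))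

  definable-induction : ∀ {n} (η : Fm (suc n)) (Ys : Fin n → C) →
    (∀ z → IsLeastAtom M z → Sat M η (z ∷ Ys)) →
    (∀ a a' → IsSucc M a a' → Sat M η (a ∷ Ys) → Sat M η (a' ∷ Ys)) →
    ∀ a → At a → Sat M η (a ∷ Ys)
  definable-induction {n} η Ys base step a at-a with em {Sat M η (a ∷ Ys)}
  ... | yes ηa = ηa
  ... | no ¬ηa = ⊥-elim (no-least-counterexample (wellFnd X X≢bot))
    where
    X : C
    X = proj₁ (compr n (η ⇒ ff) Ys)

    ∈X⇒¬η : ∀ {x} → At x → x ⊑ X → ¬ Sat M η (x ∷ Ys)
    ∈X⇒¬η {x} at-x = proj₁ (proj₂ (compr n (η ⇒ ff) Ys) x at-x)

    ¬η⇒∈X : ∀ {x} → At x → ¬ Sat M η (x ∷ Ys) → x ⊑ X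
    ¬η⇒∈X {x} at-x = proj₂ (proj₂ (compr n (η ⇒ ff) Ys) x at-x)

    X≢bot : ¬ X ≡ bot
    X≢bot X≡bot = atom⋢bot at-a (subst (a ⊑_) X≡bot (¬η⇒∈X at-a ¬ηa))

    no-least-counterexample : ¬ (Σ[ x ∈ C ] (At x × x ⊑ X × (∀ y → At y → y ⊑ X → x ≡ y ⊎ x ◁ y)))
    no-least-counterexample (x , at-x , x∈X , x-least) with em {IsLeastAtom M x}
    ... | yes x-first = ∈X⇒¬η at-x x∈X (base x x-first)
    ... | no ¬x-first with predEx x at-x ¬x-first
    ... | y , y⋖x@(at-y , _ , y◁x , _) with em {Sat M η (y ∷ Ys)}
    ... | yes ηy = ∈X⇒¬η at-x x∈X (step y x y⋖x ηy)
    ... | no ¬ηy with x-least y at-y (¬η⇒∈X at-y ¬ηy)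
    ... | inj₁ refl = irrefl◁ y at-y y◁x
    ... | inj₂ x◁y  = irrefl◁ y at-y (trans◁ y x y at-y at-x at-y y◁x x◁y)

  module _ {k : ℕ} {h : Fin (suc k)} where

    part : RhoIdx M k h → Fin (suc k) → C
    part = proj₁

    part-cover : (ρ : RhoIdx M k h) → ∀ a → At a → Σ[ i ∈ Fin (suc k) ] a ⊑ part ρ i
    part-cover (_ , _ , cover , _) a at-a = proj₁ (cover a at-a) , proj₁ (proj₂ (cover a at-a))

    part-unique : (ρ : RhoIdx M k h) → ∀ {a} → At a → ∀ {i j} → a ⊑ part ρ i → a ⊑ part ρ j → i ≡ j
    part-unique (_ , _ , cover , _) {a} at-a a∈i a∈j =
      let (_ , _ , unique) = cover a at-a in trans (unique _ a∈i) (sym (unique _ a∈j))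

    least∈part₀ : (ρ : RhoIdx M k h) → ∀ z → IsLeastAtom M z → z ⊑ part ρ F.zero
    least∈part₀ (_ , _ , _ , least , _) = least

    succ∈part-next : (ρ : RhoIdx M k h) → ∀ a a' → IsSucc M a a' →
                     ∀ i → a ⊑ part ρ i → a' ⊑ part ρ (nextIdx M i)
    succ∈part-next (_ , _ , _ , _ , next , _) = next

    greatest∈part-h : (ρ : RhoIdx M k h) → ∀ w → IsGreatestAtom M w → w ⊑ part ρ h
    greatest∈part-h (_ , _ , _ , _ , _ , greatest) = greatest

  RhoIdx-∣ : ∀ {k m hd he} → suc m ∣ suc k → (ρd : RhoIdx M k hd) (ρe : RhoIdx M m he) →
             he ≡ reduce% (suc m) hd
  RhoIdx-∣ {k} {m} {hd} e∣d ρd ρe =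
    let (w , w-last@(at-w , _)) = greatest in
    part-unique ρe at-w (greatest∈part-h ρe w w-last) (refines w at-w hd (greatest∈part-h ρd w w-last))
    where
    d e : ℕ
    d = suc k
    e = suc m

    Refines : C → Set
    Refines x = ∀ i → x ⊑ part ρd i → x ⊑ part ρe (reduce% e i)

    Ys : Fin (d + d) → C
    Ys = part ρd ++ (part ρe ∘ reduce% e)

    φ : Fin d → Fm (suc (d + d))
    φ i = (var F.zero ⊆ᶠ var (F.suc (i ↑ˡ d))) ⇒ (var F.zero ⊆ᶠ var (F.suc (d ↑ʳ i)))

    Refines⇒Sat : ∀ {x} → Refines x → Sat M (⋀ d φ) (x ∷ Ys)
    Refines⇒Sat {x} x-refines = Sat-⋀⁺ M d φ (x ∷ Ys) λ i x∈Yᵢ →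
      subst (x ⊑_) (sym (lookup-++ʳ (part ρd) _ i))
        (x-refines i (subst (x ⊑_) (lookup-++ˡ (part ρd) _ i) x∈Yᵢ))

    Sat⇒Refines : ∀ {x} → Sat M (⋀ d φ) (x ∷ Ys) → Refines x
    Sat⇒Refines {x} sat i x∈i =
      subst (x ⊑_) (lookup-++ʳ (part ρd) _ i)
        (Sat-⋀⁻ M d φ (x ∷ Ys) sat i (subst (x ⊑_) (sym (lookup-++ˡ (part ρd) _ i)) x∈i))

    least-refines : ∀ z → IsLeastAtom M z → Refines z
    least-refines z z-first@(at-z , _) i z∈i
      rewrite part-unique ρd at-z z∈i (least∈part₀ ρd z z-first)
            | reduce%-zero M {k} m
      = least∈part₀ ρe z z-first

    succ-refines : ∀ a a' → IsSucc M a a' → Refines a → Refines a'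
    succ-refines a a' a⋖a'@(at-a , at-a' , _) a-refines j a'∈j with part-cover ρd a at-a
    ... | i , a∈i
      rewrite part-unique ρd at-a' a'∈j (succ∈part-next ρd a a' a⋖a' i a∈i)
            | reduce%-nextIdx M e∣d i
      = succ∈part-next ρe a a' a⋖a' (reduce% e i) (a-refines i a∈i)

    refines : ∀ a → At a → Refines a
    refines a at-a = Sat⇒Refines (definable-induction (⋀ d φ) Ys
      (λ z z-first → Refines⇒Sat (least-refines z z-first))
      (λ a a' a⋖a' sat → Refines⇒Sat (succ-refines a a' a⋖a' (Sat⇒Refines sat)))
      a at-a)

  Rho-∣ : ∀ {d e h h'} → e ∣ d → Rho M d h → Rho M e h' → h ≡ h' [mod e ]
  Rho-∣ {suc k} {suc m} {h} {h'} e∣d ρd ρe = %-≡⇒≡[mod] (suc m) (%-cancel-pred-shift h h' e∣d (begin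
    (h + k) % suc m                                   ≡⟨ m∣n⇒o%n%m≡o%m (suc m) (suc k) (h + k) e∣d ⟨
    (h + k) % suc k % suc m                           ≡⟨ cong (_% suc m) (toℕ-fromℕ< (m%n<n (h + k) (suc k))) ⟨
    toℕ (fromℕ< (m%n<n (h + k) (suc k))) % suc m      ≡⟨ toℕ-fromℕ< _ ⟨
    toℕ (reduce% (suc m) (fromℕ< (m%n<n (h + k) (suc k))))  ≡⟨ cong toℕ (RhoIdx-∣ e∣d ρd ρe) ⟨
    toℕ (fromℕ< (m%n<n (h' + m) (suc m)))             ≡⟨ toℕ-fromℕ< (m%n<n (h' + m) (suc m)) ⟩
    (h' + m) % suc m                                  ∎))

-- Infinitude of M is what makes every ρ-index exist; here the hypothesis on r̃ supplies them.
lemma4p11 : ExcludedMiddle 0ℓ → (M : Structure) → IsMSOFin M → Infinite (Structure.C M) →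
    (r̃ : ℕ → ℕ) → (∀ d → 1 < d → r̃ d < d × Rho M d (r̃ d)) →
    IsResidueFunction r̃
lemma4p11 em M mso _ r̃ r̃-Rho =
    (λ p j → r̃ (p ^ j))
  , (λ p j p-prime 1≤j → r̃<d (prime-power>1 {j = j} p-prime 1≤j))
  , (λ p j p-prime 1≤j → r̃-∣ (prime-power>1 {j = suc j} p-prime (s≤s z≤n)) (prime-power>1 {j = j} p-prime 1≤j) (n∣m*n p))
  , (λ d → r̃<d)
  , (λ d p j 1<d p-prime 1≤j pʲ∣d → r̃-∣ 1<d (prime-power>1 {j = j} p-prime 1≤j) pʲ∣d)
  where
  r̃<d : ∀ {d} → 1 < d → r̃ d < d
  r̃<d 1<d = proj₁ (r̃-Rho _ 1<d)

  r̃-∣ : ∀ {d e} → 1 < d → 1 < e → e ∣ d → r̃ d ≡ r̃ e [mod e ]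
  r̃-∣ 1<d 1<e e∣d = Rho-∣ em M mso e∣d (proj₂ (r̃-Rho _ 1<d)) (proj₂ (r̃-Rho _ 1<e))
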